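{- Each of the numbers $41, 43, 59, 67, 82, 83, 85, 86, 89, 91, 97$ is an $ndh$-number, i.e. none of them can be written as $h-k$ with $h,k$ harmonic numbers.
   Context: A harmonic number is a positive integer of the form $2^a3^b$ with $a,b\ge 0$ integers (so $1$ is harmonic). A positive integer is an $ndh$-number if it cannot be written as a difference $h-k$ of two harmonic numbers $h,k$. -}

module Defs where

open import Data.Nat using (ℕ; _+_; _*_; _^_)
open import Data.Product using (∃₂)
open import Relation.Binary.PropositionalEquality using (_≡_)
open import Relation.Nullary using (¬_)

Harmonic : ℕ → Set
Harmonic h = ∃₂ λ a b → h ≡ 2 ^ a * 3 ^ b

-- n (positive) is an ndh-number iff there are no harmonic h, k with n = h - k.
-- Over ℕ, n = h - k with n > 0 is expressed as h ≡ n + k.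
NDH : ℕ → Set
NDH n = ¬ (∃₂ λ h k → Harmonic h × Harmonic k × h ≡ n + k)
  where open import Data.Product using (_×_)

module Submission where

-- Suppose 2^a 3^b = n + 2^c 3^d.  If a, c ≥ 1 then 2 divides n, impossible
-- for odd n; for n = 2m we may cancel a factor 2 and obtain a representation
-- of m, so it suffices that m is itself ndh (82 = 2·41, 86 = 2·43).  If
-- b, d ≥ 1 then 3 divides n, which never happens here.  In every remaining
-- case one side is a pure power or 1, leaving the three exponential equations
--   2^x = n + 3^y,    3^x = n + 2^y,    2^x 3^y = n + 1.
-- Each is refuted by a congruence: powers are eventually periodic modulo M,
-- so finitely many residues decide the equation, and small exponents are
-- excluded by size.

open import Defs
open import Data.List using (_∷_; [])
open import Data.List.Relation.Unary.All using (All)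
import Data.List.Relation.Unary.All as All

open import Data.Nat using (ℕ; zero; suc; _+_; _*_; _^_; _∸_; _%_; _/_; _≤_; _<_; _≤?_; _≟_; _<?_; NonZero; >-nonZero⁻¹)
open import Data.Nat.Properties
open import Data.Nat.DivMod using (m≡m%n+[m/n]*n; m%n<n; %-distribˡ-+; %-distribˡ-*; _mod_)
open import Data.Nat.Divisibility using (_∣_; _∣?_; ∣-trans; m∣m*n; n∣m*n; ∣m+n∣m⇒∣n)
open import Data.Fin using (Fin; toℕ; fromℕ<)
open import Data.Fin.Properties using (all?; toℕ-fromℕ<)
open import Data.Product using (_,_)
open import Relation.Binary.PropositionalEquality
open import Relation.Nullary using (¬_; Dec; yes; no)
open import Relation.Nullary.Decidable using (True; toWitness; from-no; ¬?)

open ≡-Reasoning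

periodic : {A : Set} (f : ℕ → A) (P : ℕ) .{{_ : NonZero P}} →
           (∀ y → f (P + y) ≡ f y) → ∀ x → f x ≡ f (x % P)
periodic f P shift x = begin
  f x                   ≡⟨ cong f (m≡m%n+[m/n]*n x P) ⟩
  f (x % P + x / P * P) ≡⟨ cong f (+-comm (x % P) (x / P * P)) ⟩
  f (x / P * P + x % P) ≡⟨ drop-periods (x / P) (x % P) ⟩
  f (x % P)             ∎
  where
  drop-periods : ∀ q r → f (q * P + r) ≡ f r
  drop-periods zero    r = refl
  drop-periods (suc q) r =
    trans (cong f (+-assoc P (q * P) r)) (trans (shift (q * P + r)) (drop-periods q r))

power-shift : ∀ g M L P .{{_ : NonZero M}} → g ^ (L + P) % M ≡ g ^ L % M →
              ∀ y → g ^ (L + (P + y)) % M ≡ g ^ (L + y) % M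
power-shift g M L P period y = begin
  g ^ (L + (P + y)) % M             ≡⟨ cong (λ e → g ^ e % M) (sym (+-assoc L P y)) ⟩
  g ^ (L + P + y) % M               ≡⟨ cong (_% M) (^-distribˡ-+-* g (L + P) y) ⟩
  (g ^ (L + P) * g ^ y) % M         ≡⟨ %-distribˡ-* (g ^ (L + P)) (g ^ y) M ⟩
  (g ^ (L + P) % M * (g ^ y % M)) % M ≡⟨ cong (λ r → (r * (g ^ y % M)) % M) period ⟩
  (g ^ L % M * (g ^ y % M)) % M     ≡⟨ sym (%-distribˡ-* (g ^ L) (g ^ y) M) ⟩
  (g ^ L * g ^ y) % M               ≡⟨ cong (_% M) (sym (^-distribˡ-+-* g L y)) ⟩
  g ^ (L + y) % M                   ∎

power-residue : ∀ g M L P .{{_ : NonZero M}} .{{_ : NonZero P}} →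
                g ^ (L + P) % M ≡ g ^ L % M →
                ∀ x → g ^ (L + x) % M ≡ g ^ (L + x % P) % M
power-residue g M L P period = periodic (λ x → g ^ (L + x) % M) P (power-shift g M L P period)

toℕ-mod : ∀ x P .{{_ : NonZero P}} → toℕ (x mod P) ≡ x % P
toℕ-mod x P = toℕ-fromℕ< (m%n<n x P)

+-cong-mod : ∀ n {a b} M .{{_ : NonZero M}} → a % M ≡ b % M → (n + a) % M ≡ (n + b) % M
+-cong-mod n {a} {b} M a≡b = begin
  (n + a) % M           ≡⟨ %-distribˡ-+ n a M ⟩
  (n % M + a % M) % M   ≡⟨ cong (λ r → (n % M + r) % M) a≡b ⟩
  (n % M + b % M) % M   ≡⟨ sym (%-distribˡ-+ n b M) ⟩
  (n + b) % M           ∎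

*-cong-mod : ∀ {a a′ b b′} M .{{_ : NonZero M}} →
             a % M ≡ a′ % M → b % M ≡ b′ % M → (a * b) % M ≡ (a′ * b′) % M
*-cong-mod {a} {a′} {b} {b′} M a≡a′ b≡b′ = begin
  (a * b) % M               ≡⟨ %-distribˡ-* a b M ⟩
  (a % M * (b % M)) % M     ≡⟨ cong₂ (λ r s → (r * s) % M) a≡a′ b≡b′ ⟩
  (a′ % M * (b′ % M)) % M   ≡⟨ sym (%-distribˡ-* a′ b′ M) ⟩
  (a′ * b′) % M             ∎

PowerGapTable : (g h n M L P Q : ℕ) .{{_ : NonZero M}} → Set
PowerGapTable g h n M L P Q =
  ∀ (i : Fin P) (j : Fin Q) → ¬ (g ^ (L + toℕ i) % M ≡ (n + h ^ toℕ j) % M)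

power-gap-table? : ∀ g h n M L P Q .{{_ : NonZero M}} → Dec (PowerGapTable g h n M L P Q)
power-gap-table? g h n M L P Q =
  all? λ i → all? λ j → ¬? (g ^ (L + toℕ i) % M ≟ (n + h ^ toℕ j) % M)

small-power-gap : ∀ g h n x y .{{_ : NonZero h}} → g ^ x ≤ n → ¬ (g ^ x ≡ n + h ^ y)
small-power-gap g h n x y small eq = ≤⇒≯ small (subst (n <_) (sym eq) (m<m+n n (m^n>0 h y)))

large-power-gap : ∀ g h n M L P Q .{{_ : NonZero M}} .{{_ : NonZero P}} .{{_ : NonZero Q}} →
                  g ^ (L + P) % M ≡ g ^ L % M → h ^ Q % M ≡ 1 % M →
                  PowerGapTable g h n M L P Q → ∀ x y → ¬ (g ^ (L + x) ≡ n + h ^ y)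
large-power-gap g h n M L P Q g-period h-period table x y eq = table (x mod P) (y mod Q) (begin
  g ^ (L + toℕ (x mod P)) % M  ≡⟨ cong (λ e → g ^ (L + e) % M) (toℕ-mod x P) ⟩
  g ^ (L + x % P) % M          ≡⟨ sym (power-residue g M L P g-period x) ⟩
  g ^ (L + x) % M              ≡⟨ cong (_% M) eq ⟩
  (n + h ^ y) % M              ≡⟨ +-cong-mod n M (power-residue h M 0 Q h-period y) ⟩
  (n + h ^ (y % Q)) % M        ≡⟨ cong (λ e → (n + h ^ e) % M) (sym (toℕ-mod y Q)) ⟩
  (n + h ^ toℕ (y mod Q)) % M  ∎)

-- The finite hypotheses are implicit arguments of
-- type True (…), discharged by evaluation at closed instances.
power-gap-free : ∀ g h n M L P Q .{{_ : NonZero h}} .{{_ : NonZero M}} .{{_ : NonZero P}} .{{_ : NonZero Q}} →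
                 {small : True (all? λ (i : Fin L) → g ^ toℕ i ≤? n)} →
                 {g-period : True (g ^ (L + P) % M ≟ g ^ L % M)} →
                 {h-period : True (h ^ Q % M ≟ 1 % M)} →
                 {table : True (power-gap-table? g h n M L P Q)} →
                 ∀ x y → ¬ (g ^ x ≡ n + h ^ y)
power-gap-free g h n M L P Q {small} {g-period} {h-period} {table} x y with x <? L
... | yes x<L = small-power-gap g h n x y
                  (subst (λ e → g ^ e ≤ n) (toℕ-fromℕ< x<L) (toWitness small (fromℕ< x<L)))
... | no x≮L = subst (λ e → ¬ (g ^ e ≡ n + h ^ y)) (m+[n∸m]≡n (≮⇒≥ x≮L))
                 (large-power-gap g h n M L P Q (toWitness g-period) (toWitness h-period)
                   (toWitness table) (x ∸ L) y)

ProductTable : (g h m M P Q : ℕ) .{{_ : NonZero M}} → Set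
ProductTable g h m M P Q = ∀ (i : Fin P) (j : Fin Q) → ¬ ((g ^ toℕ i * h ^ toℕ j) % M ≡ m % M)

product-table? : ∀ g h m M P Q .{{_ : NonZero M}} → Dec (ProductTable g h m M P Q)
product-table? g h m M P Q = all? λ i → all? λ j → ¬? ((g ^ toℕ i * h ^ toℕ j) % M ≟ m % M)

product-gap-free : ∀ g h m M P Q .{{_ : NonZero M}} .{{_ : NonZero P}} .{{_ : NonZero Q}} →
                   {g-period : True (g ^ P % M ≟ 1 % M)} →
                   {h-period : True (h ^ Q % M ≟ 1 % M)} →
                   {table : True (product-table? g h m M P Q)} →
                   ∀ x y → ¬ (g ^ x * h ^ y ≡ m)
product-gap-free g h m M P Q {g-period} {h-period} {table} x y eq =
  toWitness table (x mod P) (y mod Q) (begin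
    (g ^ toℕ (x mod P) * h ^ toℕ (y mod Q)) % M
      ≡⟨ cong₂ (λ e f → (g ^ e * h ^ f) % M) (toℕ-mod x P) (toℕ-mod y Q) ⟩
    (g ^ (x % P) * h ^ (y % Q)) % M
      ≡⟨ *-cong-mod M (sym (power-residue g M 0 P (toWitness g-period) x))
                      (sym (power-residue h M 0 Q (toWitness h-period) y)) ⟩
    (g ^ x * h ^ y) % M
      ≡⟨ cong (_% M) eq ⟩
    m % M ∎)

EvenGapFree : ℕ → Set
EvenGapFree n = ∀ a b c d → ¬ (2 ^ suc a * 3 ^ b ≡ n + 2 ^ suc c * 3 ^ d)

common-divisor : ∀ {p k} n → p ∣ n + k → p ∣ k → p ∣ n
common-divisor {p} {k} n p∣n+k p∣k = ∣m+n∣m⇒∣n (subst (p ∣_) (+-comm n k) p∣n+k) p∣k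

2∣even-harmonic : ∀ a b → 2 ∣ 2 ^ suc a * 3 ^ b
2∣even-harmonic a b = ∣-trans (m∣m*n (2 ^ a)) (m∣m*n (3 ^ b))

3∣harmonic : ∀ a b → 3 ∣ 2 ^ a * 3 ^ suc b
3∣harmonic a b = ∣-trans (m∣m*n (3 ^ b)) (n∣m*n (2 ^ a))

odd-even-gap-free : ∀ n → ¬ (2 ∣ n) → EvenGapFree n
odd-even-gap-free n 2∤n a b c d eq =
  2∤n (common-divisor n (subst (2 ∣_) eq (2∣even-harmonic a b)) (2∣even-harmonic c d))

-- For 2m, cancelling the common factor 2 turns an even representation of 2m
-- into a representation of m.
double-even-gap-free : ∀ m → NDH m → EvenGapFree (2 * m)
double-even-gap-free m ndh a b c d eq =
  ndh (H , K , (a , b , refl) , (c , d , refl) , *-cancelˡ-≡ H (m + K) 2 (begin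
    2 * H                   ≡⟨ sym (*-assoc 2 (2 ^ a) (3 ^ b)) ⟩
    2 ^ suc a * 3 ^ b       ≡⟨ eq ⟩
    2 * m + 2 ^ suc c * 3 ^ d ≡⟨ cong (2 * m +_) (*-assoc 2 (2 ^ c) (3 ^ d)) ⟩
    2 * m + 2 * K           ≡⟨ sym (*-distribˡ-+ 2 m K) ⟩
    2 * (m + K)             ∎))
  where
  H = 2 ^ a * 3 ^ b
  K = 2 ^ c * 3 ^ d

harmonic-pos : ∀ c d → 1 ≤ 2 ^ c * 3 ^ d
harmonic-pos c d = *-mono-≤ (m^n>0 2 c) (m^n>0 3 d)

ndh-criterion : ∀ n .{{_ : NonZero n}} → ¬ (3 ∣ n) → EvenGapFree n →
                (∀ x y → ¬ (2 ^ x ≡ n + 3 ^ y)) →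
                (∀ x y → ¬ (3 ^ x ≡ n + 2 ^ y)) →
                (∀ x y → ¬ (2 ^ x * 3 ^ y ≡ n + 1)) → NDH n
ndh-criterion n 3∤n even pow2 pow3 prod (_ , _ , (a , b , refl) , (c , d , refl) , eq) =
  gap a b c d eq
  where
  gap : ∀ a b c d → ¬ (2 ^ a * 3 ^ b ≡ n + 2 ^ c * 3 ^ d)
  gap (suc a) b (suc c) d e = even a b c d e
  gap a (suc b) c (suc d) e =
    3∤n (common-divisor n (subst (3 ∣_) e (3∣harmonic a b)) (3∣harmonic c d))
  gap zero zero c d e =
    <⇒≢ (+-mono-≤ (>-nonZero⁻¹ n) (harmonic-pos c d)) e
  gap a b zero zero e = prod a b e
  gap zero b c zero e =
    pow3 b c (trans (sym (*-identityˡ (3 ^ b))) (trans e (cong (n +_) (*-identityʳ (2 ^ c)))))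
  gap a zero zero d e =
    pow2 a d (trans (sym (*-identityʳ (2 ^ a))) (trans e (cong (n +_) (*-identityˡ (3 ^ d)))))

-- Each proof gives, in order: 3 ∤ n, the parity
-- argument, the data (M, L, P, Q) refuting 2^x = n + 3^y, the data refuting
-- 3^x = n + 2^y, and the data (M, P, Q) refuting 2^x 3^y = n + 1.
ndh41 : NDH 41
ndh41 = ndh-criterion 41 (from-no (3 ∣? 41))
  (odd-even-gap-free 41 (from-no (2 ∣? 41)))
  (power-gap-free 2 3 41 8 3 1 2) (power-gap-free 3 2 41 117 4 3 12) (product-gap-free 2 3 42 7 3 6)

ndh43 : NDH 43
ndh43 = ndh-criterion 43 (from-no (3 ∣? 43))
  (odd-even-gap-free 43 (from-no (2 ∣? 43)))
  (power-gap-free 2 3 43 8 3 1 2) (power-gap-free 3 2 43 117 4 3 12) (product-gap-free 2 3 44 11 10 5)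

ndh59 : NDH 59
ndh59 = ndh-criterion 59 (from-no (3 ∣? 59))
  (odd-even-gap-free 59 (from-no (2 ∣? 59)))
  (power-gap-free 2 3 59 8 3 1 2) (power-gap-free 3 2 59 63 4 6 6) (product-gap-free 2 3 60 5 4 4)

ndh67 : NDH 67
ndh67 = ndh-criterion 67 (from-no (3 ∣? 67))
  (odd-even-gap-free 67 (from-no (2 ∣? 67)))
  (power-gap-free 2 3 67 8 3 1 2) (power-gap-free 3 2 67 91 4 6 12) (product-gap-free 2 3 68 73 9 12)

ndh82 : NDH 82
ndh82 = ndh-criterion 82 (from-no (3 ∣? 82))
  (double-even-gap-free 41 ndh41)
  (power-gap-free 2 3 82 2 1 1 1) (power-gap-free 3 2 82 91 5 6 12) (product-gap-free 2 3 83 73 9 12)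

ndh83 : NDH 83
ndh83 = ndh-criterion 83 (from-no (3 ∣? 83))
  (odd-even-gap-free 83 (from-no (2 ∣? 83)))
  (power-gap-free 2 3 83 8 3 1 2) (power-gap-free 3 2 83 117 5 3 12) (product-gap-free 2 3 84 7 3 6)

ndh85 : NDH 85
ndh85 = ndh-criterion 85 (from-no (3 ∣? 85))
  (odd-even-gap-free 85 (from-no (2 ∣? 85)))
  (power-gap-free 2 3 85 91 7 12 6) (power-gap-free 3 2 85 91 5 6 12) (product-gap-free 2 3 86 73 9 12)

ndh86 : NDH 86
ndh86 = ndh-criterion 86 (from-no (3 ∣? 86))
  (double-even-gap-free 43 ndh43)
  (power-gap-free 2 3 86 2 1 1 1) (power-gap-free 3 2 86 117 5 3 12) (product-gap-free 2 3 87 73 9 12)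

ndh89 : NDH 89
ndh89 = ndh-criterion 89 (from-no (3 ∣? 89))
  (odd-even-gap-free 89 (from-no (2 ∣? 89)))
  (power-gap-free 2 3 89 8 3 1 2) (power-gap-free 3 2 89 117 5 3 12) (product-gap-free 2 3 90 5 4 4)

ndh91 : NDH 91
ndh91 = ndh-criterion 91 (from-no (3 ∣? 91))
  (odd-even-gap-free 91 (from-no (2 ∣? 91)))
  (power-gap-free 2 3 91 8 3 1 2) (power-gap-free 3 2 91 39 5 3 12) (product-gap-free 2 3 92 23 11 11)

ndh97 : NDH 97
ndh97 = ndh-criterion 97 (from-no (3 ∣? 97))
  (odd-even-gap-free 97 (from-no (2 ∣? 97)))
  (power-gap-free 2 3 97 8 3 1 2) (power-gap-free 3 2 97 117 5 3 12) (product-gap-free 2 3 98 7 3 6)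

theorem2p2 : All NDH (41 ∷ 43 ∷ 59 ∷ 67 ∷ 82 ∷ 83 ∷ 85 ∷ 86 ∷ 89 ∷ 91 ∷ 97 ∷ [])
theorem2p2 = ndh41 All.∷ ndh43 All.∷ ndh59 All.∷ ndh67 All.∷ ndh82 All.∷ ndh83 All.∷
             ndh85 All.∷ ndh86 All.∷ ndh89 All.∷ ndh91 All.∷ ndh97 All.∷ All.[]
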